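{- Let $a,b,c,d$ be positive integers with $a\le 5$ and $d\le 41$. If $b>102$ and $c>102$, then $$(b+c+1)\,(abc+abd+acd+bcd+ab+ac+ad+bc+bd+cd+a+b+c+d+1) < b(b+1)c(c+1),$$ i.e. the inequality $(b+c+1)(abc+abd+acd+bcd+ab+ac+ad+bc+bd+cd+a+b+c+d+1)\ge b(b+1)c(c+1)$ is not satisfied.
   Context: The inequality is a necessary condition for $(a,b,c,d)$ to be the first diagonal of an arithmetic Y-frieze pattern of width $4$. -}

module Defs where

-- Put P = bc and S = b + c + 1. Then b(b+1)c(c+1) = PS + P² and the left side is
-- PS + (a+d)·PS + (a+1)(d+1)·S², so with a + d ≤ 46 and (a+1)(d+1) ≤ 252 it suffices
-- that 46·PS + 252·S² < P². For b, c ≥ 103 the ratio P/S is at least 10609/207 ≈ 51.25,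
-- which exceeds the positive root 23 + √781 ≈ 50.95 of t² = 46t + 252.
module Submission where

open import Defs
open import Data.Nat using (ℕ; _+_; _*_; _≤_; _<_; _∸_; NonZero; >-nonZero)
open import Data.Nat.Properties
open import Data.Nat.Solver using (module +-*-Solver)
open import Relation.Binary.PropositionalEquality
open +-*-Solver

-- Multiplying through by q² lets the ratio bound q·S ≤ r·P replace each factor q·S by r·P.
quadratic-<-square : ∀ {A B q r P S} → A * r * q + B * (r * r) < q * q →
  q * S ≤ r * P → 0 < P → A * (P * S) + B * (S * S) < P * P
quadratic-<-square {A} {B} {q} {r} {P} {S} hcoeff hratio hP =
  *-cancelˡ-< (q * q) _ _ (begin-strict
    q * q * (A * (P * S) + B * (S * S))       ≡⟨ scale-by-q ⟩
    A * (q * P) * (q * S) + B * (q * S * (q * S))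
      ≤⟨ +-mono-≤ (*-monoʳ-≤ (A * (q * P)) hratio) (*-monoʳ-≤ B (*-mono-≤ hratio hratio)) ⟩
    A * (q * P) * (r * P) + B * (r * P * (r * P)) ≡⟨ collect ⟩
    (A * r * q + B * (r * r)) * (P * P)       <⟨ *-monoˡ-< (P * P) {{PP≢0}} hcoeff ⟩
    q * q * (P * P)                           ∎)
  where
  open ≤-Reasoning
  PP≢0 : NonZero (P * P)
  PP≢0 = >-nonZero (*-mono-< hP hP)
  scale-by-q : q * q * (A * (P * S) + B * (S * S))
             ≡ A * (q * P) * (q * S) + B * (q * S * (q * S))
  scale-by-q = solve 5 (λ A B q P S →
      q :* q :* (A :* (P :* S) :+ B :* (S :* S))
    := A :* (q :* P) :* (q :* S) :+ B :* (q :* S :* (q :* S))) refl A B q P S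
  collect : A * (q * P) * (r * P) + B * (r * P * (r * P))
          ≡ (A * r * q + B * (r * r)) * (P * P)
  collect = solve 5 (λ A B q r P →
      A :* (q :* P) :* (r :* P) :+ B :* (r :* P :* (r :* P))
    := (A :* r :* q :+ B :* (r :* r)) :* (P :* P)) refl A B q r P

-- With b = k + x and c = k + y the difference is (k² + k)(x + y) + (2k + 1)xy.
sum-≤-product-ratio : ∀ {k b c} → k ≤ b → k ≤ c →
  k * k * (b + c + 1) ≤ (k + k + 1) * (b * c)
sum-≤-product-ratio {k} {b} {c} k≤b k≤c
  rewrite sym (m+[n∸m]≡n k≤b) | sym (m+[n∸m]≡n k≤c) =
  subst (k * k * ((k + x) + (k + y) + 1) ≤_) (sym (shifted k x y)) (m≤m+n _ _)
  where
  x = b ∸ k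
  y = c ∸ k
  shifted : ∀ k x y → (k + k + 1) * ((k + x) * (k + y))
          ≡ k * k * ((k + x) + (k + y) + 1) + ((k * k + k) * (x + y) + (k + k + 1) * (x * y))
  shifted = solve 3 (λ k x y →
      (k :+ k :+ con 1) :* ((k :+ x) :* (k :+ y))
    := k :* k :* ((k :+ x) :+ (k :+ y) :+ con 1)
       :+ ((k :* k :+ k) :* (x :+ y) :+ (k :+ k :+ con 1) :* (x :* y))) refl

quadratic-<-square-103 : ∀ {b c} → 102 < b → 102 < c →
  46 * ((b * c) * (b + c + 1)) + 252 * ((b + c + 1) * (b + c + 1)) < (b * c) * (b * c)
quadratic-<-square-103 {b} {c} hb hc =
  quadratic-<-square {A = 46} {B = 252} {q = 10609} {r = 207} {P = b * c} {S = b + c + 1}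
  (<ᵇ⇒< _ _ _) (sum-≤-product-ratio hb hc) (<-≤-trans (<ᵇ⇒< 0 10609 _) (*-mono-≤ hb hc))

lhs-expand : ∀ a b c d → (b + c + 1) * (a * b * c + a * b * d + a * c * d + b * c * d
    + a * b + a * c + a * d + b * c + b * d + c * d + a + b + c + d + 1)
  ≡ (b * c) * (b + c + 1)
    + ((a + d) * ((b * c) * (b + c + 1)) + (a + 1) * (d + 1) * ((b + c + 1) * (b + c + 1)))
lhs-expand = solve 4 (λ a b c d →
    (b :+ c :+ con 1) :* (a :* b :* c :+ a :* b :* d :+ a :* c :* d :+ b :* c :* d
      :+ a :* b :+ a :* c :+ a :* d :+ b :* c :+ b :* d :+ c :* d :+ a :+ b :+ c :+ d :+ con 1)
  := (b :* c) :* (b :+ c :+ con 1)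
     :+ ((a :+ d) :* ((b :* c) :* (b :+ c :+ con 1))
        :+ (a :+ con 1) :* (d :+ con 1) :* ((b :+ c :+ con 1) :* (b :+ c :+ con 1)))) refl

rhs-expand : ∀ b c → b * (b + 1) * c * (c + 1) ≡ (b * c) * (b + c + 1) + (b * c) * (b * c)
rhs-expand = solve 2 (λ b c →
    b :* (b :+ con 1) :* c :* (c :+ con 1)
  := (b :* c) :* (b :+ c :+ con 1) :+ (b :* c) :* (b :* c)) refl

proposition3p4 : (a b c d : ℕ) → 1 ≤ a → 1 ≤ b → 1 ≤ c → 1 ≤ d →
    a ≤ 5 → d ≤ 41 → 102 < b → 102 < c →
    (b + c + 1) * (a * b * c + a * b * d + a * c * d + b * c * d
      + a * b + a * c + a * d + b * c + b * d + c * d + a + b + c + d + 1)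
      < b * (b + 1) * c * (c + 1)
proposition3p4 a b c d _ _ _ _ a≤5 d≤41 hb hc =
  subst₂ _<_ (sym (lhs-expand a b c d)) (sym (rhs-expand b c))
    (+-monoʳ-< (P * S) (≤-<-trans coefficients-≤ (quadratic-<-square-103 hb hc)))
  where
  P = b * c
  S = b + c + 1
  coefficients-≤ : (a + d) * (P * S) + (a + 1) * (d + 1) * (S * S) ≤ 46 * (P * S) + 252 * (S * S)
  coefficients-≤ = +-mono-≤ (*-monoˡ-≤ (P * S) (+-mono-≤ a≤5 d≤41))
    (*-monoˡ-≤ (S * S) (*-mono-≤ (+-monoˡ-≤ 1 a≤5) (+-monoˡ-≤ 1 d≤41)))
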